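{- Let $W=(w_1,\ldots,w_n)$ be an ordered list of pairwise distinct strings over a finite alphabet $A$, and let $SHT(W)$ be its sequence hash tree (defined in the context). Then every node of $SHT(W)$ points to at most two strings of $W$.
   Context: A trie is a rooted tree whose edges are directed away from the root and labeled by letters of $A$, such that the edges from a node to its children carry distinct letters; the path label of a node is the concatenation of edge labels on the path from the root to it, and a string is represented in the trie if it is the path label of some node. Sequence hash tree: $SHT_0(W)$ is the trie consisting of a single root node (pointing to no string). For $i\ge 0$, $SHT_{i+1}(W)$ is obtained from $SHT_i(W)$ as follows: if $w_{i+1}$ is already represented in $SHT_i(W)$, a pointer to $w_{i+1}$ is added to the node whose path label is $w_{i+1}$; otherwise, let $v'$ be the longest prefix of $w_{i+1}$ represented in $SHT_i(W)$ and let $a$ be the letter following $v'$ in $w_{i+1}$, and add a new node, child of the node $v'$ via an $a$-edge, pointing to $w_{i+1}$. Finally $SHT(W)=SHT_n(W)$. A node may thus point to several strings of $W$. -}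

module Defs where

open import Data.Nat using (ℕ; suc)
open import Data.Bool using (Bool; true; false; if_then_else_)
open import Data.List using (List; []; _∷_; _++_; [_]; map; foldl; inits; drop; length)
open import Data.List.Relation.Unary.Any using (Any; any?)
open import Data.List.Properties using (≡-dec)
open import Data.Product using (_×_; _,_; proj₁; proj₂)
open import Relation.Binary.Definitions using (DecidableEquality)
open import Relation.Binary.PropositionalEquality using (_≡_)
open import Relation.Nullary using (Dec; yes; no; does)

module SHT {A : Set} (_≟_ : DecidableEquality A) where

  Str : Set
  Str = List A

  -- A node of the trie: its path label (which determines the node, since the
  -- edges out of a node carry distinct letters) together with the list of
  -- (1-based) indices i of the strings w_i of W that it points to.
  Node : Set
  Node = Str × List ℕ

  label : Node → Str
  label = proj₁

  pointers : Node → List ℕ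
  pointers = proj₂

  Trie : Set
  Trie = List Node

  _≟s_ : DecidableEquality Str
  _≟s_ = ≡-dec _≟_

  Represented : Trie → Str → Set
  Represented T v = Any (λ nd → label nd ≡ v) T

  represented? : (T : Trie) → (v : Str) → Dec (Represented T v)
  represented? T v = any? (λ nd → label nd ≟s v) T

  -- The longest prefix of w represented in T (prefixes of w are enumerated by
  -- increasing length by `inits`; the empty prefix is the root).
  longestRepPrefix : Trie → Str → Str
  longestRepPrefix T w =
    foldl (λ acc p → if does (represented? T p) then p else acc) [] (inits w)

  SHT₀ : Trie
  SHT₀ = ([] , []) ∷ []

  addPointer : ℕ → Str → Node → Node
  addPointer i w (l , ps) = if does (l ≟s w) then (l , ps ++ [ i ]) else (l , ps)

  step : Trie → ℕ → Str → Trie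
  step T i w with represented? T w
  ... | yes _ = map (addPointer i w) T
  ... | no _ with drop (length (longestRepPrefix T w)) w
  ...   | []    = T   -- unreachable: v' is a proper prefix of w here
  ...   | a ∷ _ = T ++ [ (longestRepPrefix T w ++ [ a ] , [ i ]) ]

  build : ℕ → Trie → List Str → Trie
  build k T []       = T
  build k T (w ∷ ws) = build (suc k) (step T k w) ws

  -- SHT(W) = SHT_n(W); strings are numbered from 1.
  sht : List Str → Trie
  sht W = build 1 SHT₀ W

-- A node receives its first pointer when it is created and a further one only
-- when the inserted string equals its path label.  Since the strings of W are
-- distinct, this can happen at most once per node.  The invariant carried
-- through the construction is therefore: every node has at most one pointer,
-- or it has two and its label does not occur among the strings still to be
-- inserted.
module Submission where

open import Defs
open import Data.Nat using (ℕ; _≤_; suc; z≤n)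
open import Data.Nat.Properties using (≤-refl; +-monoˡ-≤; n≤1+n; ≤-trans)
open import Data.Fin using (Fin)
open import Data.List using (List; length; []; _∷_; _++_; [_]; drop)
open import Data.List.Properties using (length-++)
open import Data.List.Membership.Propositional using (_∈_; _∉_)
open import Data.List.Relation.Unary.Any using (here; there)
open import Data.List.Relation.Unary.All as All using (All; []; _∷_)
open import Data.List.Relation.Unary.All.Properties using (map⁺; ++⁺; All¬⇒¬Any)
open import Data.List.Relation.Unary.AllPairs using (_∷_)
open import Data.List.Relation.Unary.Unique.Propositional using (Unique)
open import Data.Product using (∃; _,_)
open import Data.Empty using (⊥-elim)
open import Function.Bundles using (_↔_)
open import Relation.Binary.Definitions using (DecidableEquality)
open import Relation.Binary.PropositionalEquality using (refl; subst; sym)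
open import Relation.Nullary using (yes; no)

length-∷ʳ-≤ : ∀ {B : Set} (xs : List B) (x : B) → length xs ≤ 1 → length (xs ++ [ x ]) ≤ 2
length-∷ʳ-≤ xs x |xs|≤1 = subst (_≤ 2) (sym (length-++ xs)) (+-monoˡ-≤ 1 |xs|≤1)

module _ {A : Set} (_≟_ : DecidableEquality A) where
  open SHT _≟_

  data Admissible (pending : List Str) (nd : Node) : Set where
    atMostOne : length (pointers nd) ≤ 1 → Admissible pending nd
    atMostTwo : length (pointers nd) ≤ 2 → label nd ∉ pending → Admissible pending nd

  Admissible-∷⁻ : ∀ {w pending nd} → Admissible (w ∷ pending) nd → Admissible pending nd
  Admissible-∷⁻ (atMostOne ≤1)       = atMostOne ≤1
  Admissible-∷⁻ (atMostTwo ≤2 ∉w∷ws) = atMostTwo ≤2 (λ ∈ws → ∉w∷ws (there ∈ws))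

  addPointer-Admissible : ∀ i {w pending} → w ∉ pending →
    ∀ nd → Admissible (w ∷ pending) nd → Admissible pending (addPointer i w nd)
  addPointer-Admissible i {w} w∉ (l , ps) adm with l ≟s w
  ... | no _ = Admissible-∷⁻ adm
  ... | yes refl with adm
  ...   | atMostOne ≤1  = atMostTwo (length-∷ʳ-≤ ps i ≤1) w∉
  ...   | atMostTwo _ ∉ = ⊥-elim (∉ (here refl))

  step-Admissible : ∀ T i {w pending} → w ∉ pending →
    All (Admissible (w ∷ pending)) T → All (Admissible pending) (step T i w)
  step-Admissible T i {w} w∉ adm with represented? T w
  ... | yes _ = map⁺ (All.tabulate λ {nd} nd∈T →
                  addPointer-Admissible i w∉ nd (All.lookup adm nd∈T))
  ... | no _ with drop (length (longestRepPrefix T w)) w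
  ...   | []    = All.map Admissible-∷⁻ adm
  ...   | _ ∷ _ = ++⁺ (All.map Admissible-∷⁻ adm) (atMostOne ≤-refl ∷ [])

  build-Admissible : ∀ k T {ws} → Unique ws →
    All (Admissible ws) T → All (Admissible []) (build k T ws)
  build-Admissible k T {[]}     _            adm = adm
  build-Admissible k T {w ∷ ws} (w∉ws ∷ uniq) adm =
    build-Admissible (suc k) (step T k w) uniq (step-Admissible T k (All¬⇒¬Any w∉ws) adm)

  SHT₀-Admissible : ∀ ws → All (Admissible ws) SHT₀
  SHT₀-Admissible ws = atMostOne z≤n ∷ []

  Admissible-[]⇒≤2 : ∀ {nd} → Admissible [] nd → length (pointers nd) ≤ 2
  Admissible-[]⇒≤2 (atMostOne ≤1)   = ≤-trans ≤1 (n≤1+n 1)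
  Admissible-[]⇒≤2 (atMostTwo ≤2 _) = ≤2

lemma1 : {A : Set} (_≟_ : DecidableEquality A) → (∃ λ (k : ℕ) → A ↔ Fin k) →
         (W : List (List A)) → Unique W →
         (nd : SHT.Node _≟_) → nd ∈ SHT.sht _≟_ W → length (SHT.pointers _≟_ nd) ≤ 2
lemma1 _≟_ _ W uniq nd nd∈ =
  Admissible-[]⇒≤2 _≟_ (All.lookup admissible nd∈)
  where
  admissible : All (Admissible _≟_ []) (SHT.sht _≟_ W)
  admissible = build-Admissible _≟_ 1 (SHT.SHT₀ _≟_) uniq (SHT₀-Admissible _≟_ W)
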